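{- Let $(\alpha,\mu)\in\mathbb{Q}_{\ge0}^X\times\mathbb{Q}$, $r\ge0$, $S\subseteq X$ with $d(s,s')>4r$ for all $s,s'\in S$ with $s\ne s'$, and $\tau\in\{0,\dots,k-1\}$. If there is a set $C_1\in\mathcal{F}^{\alpha,\mu}(r)$ with $|C_1\cap B(S,r)|>\tau$, then there is a set $C_2\in\mathcal{F}^{\alpha,\mu}(2r)$ with $|C_2\setminus S|\le k-\tau-1$.
   Context: A $\gamma$-Colorful $k$-Center instance: integers $\gamma,k\ge1$, a finite metric space $(X,d)$, subsets $X_\ell\subseteq X$ ($\ell\in[\gamma]$), $m\in\mathbb{Z}_{\ge0}^\gamma$. $B(A,r)=\{u\in X:\exists a\in A,\ d(a,u)\le r\}$. $\mathcal{F}(r)=\{C\subseteq X:|C|\le k,\ |B(C,r)\cap X_\ell|\ge m_\ell\ \forall\ell\in[\gamma]\}$ and $\mathcal{F}^{\alpha,\mu}(r)=\{C\in\mathcal{F}(r):\sum_{u\in B(C,r)}\alpha(u)>\mu\}$.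
   Formalization: The distances of the metric d and the radius r are rational. -}

module Defs where

open import Data.Nat using (ℕ; zero; suc)
open import Data.Fin using (Fin)
open import Data.Fin.Subset using (Subset; _∈_; _∩_; ∣_∣)
open import Data.Fin.Subset.Properties using (_∈?_)
open import Data.Fin.Properties using (any?)
open import Data.Rational using (ℚ; 0ℚ; _+_; _*_; _≤_; _<_; _≤ᵇ_)
open import Data.Rational.Properties using (_≤?_)
open import Data.Product using (_×_; Σ)
open import Data.Bool using (Bool; if_then_else_)
open import Data.Vec using (tabulate)
open import Relation.Nullary using (does; ¬_)
open import Relation.Nullary.Decidable using (_×-dec_)
open import Relation.Binary.PropositionalEquality using (_≡_)

record FiniteMetric (n : ℕ) : Set where
  field
    d          : Fin n → Fin n → ℚ
    nonneg     : ∀ x y → 0ℚ ≤ d x y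
    zero-self  : ∀ x → d x x ≡ 0ℚ
    zero⇒eq    : ∀ x y → d x y ≡ 0ℚ → x ≡ y
    sym        : ∀ x y → d x y ≡ d y x
    triangle   : ∀ x y z → d x z ≤ d x y + d y z
open FiniteMetric public

Ball : ∀ {n} → FiniteMetric n → Subset n → ℚ → Subset n
Ball M A r = tabulate λ u → does (any? λ a → (a ∈? A) ×-dec (d M a u ≤? r))

sumOver : ∀ {n} → (Fin n → ℚ) → Subset n → ℚ
sumOver {zero}  α A = 0ℚ
sumOver {suc n} α A = go (Data.Vec.head A) Data.Fin.zero + sumOver (λ i → α (Data.Fin.suc i)) (Data.Vec.tail A)
  where
  go : Bool → Fin (suc n) → ℚ
  go b i = if b then α i else 0ℚ

record ColorfulInstance (n : ℕ) : Set where
  field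
    γ      : ℕ
    k      : ℕ
    metric : FiniteMetric n
    color  : Fin γ → Subset n
    m      : Fin γ → ℕ
open ColorfulInstance public

Feasible : ∀ {n} → ColorfulInstance n → ℚ → Subset n → Set
Feasible I r C =
  ∣ C ∣ Data.Nat.≤ k I ×
  (∀ ℓ → m I ℓ Data.Nat.≤ ∣ Ball (metric I) C r ∩ color I ℓ ∣)

FeasibleAM : ∀ {n} → ColorfulInstance n → (Fin n → ℚ) → ℚ → ℚ → Subset n → Set
FeasibleAM I α μ r C = Feasible I r C × (μ < sumOver α (Ball (metric I) C r))

module Submission where

open import Defs
open import Data.Nat using (ℕ; _∸_; suc)
open import Data.Fin using (Fin)
open import Data.Fin.Subset using (Subset; _∈_; _∩_; _─_; ∣_∣)
open import Data.Rational using (ℚ; 0ℚ; _≤_; _<_; _*_; 1ℚ; _+_)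
open import Data.Product using (_×_; Σ-syntax)
open import Relation.Nullary using (¬_)
open import Relation.Binary.PropositionalEquality using (_≡_)

import Data.Nat as ℕ
import Data.Nat.Properties as ℕₚ
import Data.Rational.Properties as ℚₚ
open import Data.Bool using (true)
open import Data.Empty using (⊥-elim)
open import Data.Fin.Subset using (_⊆_; _∪_; _∉_; ⁅_⁆; ⊥; inside; outside)
open import Data.Fin.Subset.Properties
open import Data.Fin.Properties using (any?)
open import Data.Product using (_,_; proj₁; proj₂; ∃)
open import Data.Sum using (inj₁; inj₂)
open import Data.Vec using ([]; _∷_; tabulate; here; there)
open import Data.Vec.Properties using (lookup∘tabulate; []=⇒lookup; lookup⇒[]=)
open import Relation.Nullary using (Dec; yes; no; does)
open import Relation.Nullary.Decidable using (_×-dec_)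
open import Relation.Binary.PropositionalEquality using (refl; trans; cong; subst) renaming (sym to ≡-sym)

-- Every centre of C₁ inside B(S, r) is moved to a point of S within distance r
-- of it; the other centres stay. By the triangle inequality every point
-- covered within r by C₁ is covered within 2r by the new set C₂, which has at
-- most |C₁| points, and all of them outside S are old centres outside B(S, r),
-- of which there are at most |C₁| − (τ + 1) ≤ k − τ − 1.

∈-tabulate-does⁻ : ∀ {n} {P : Fin n → Set} (P? : ∀ x → Dec (P x)) {x} →
  x ∈ tabulate (λ y → does (P? y)) → P x
∈-tabulate-does⁻ P? {x} x∈ with P? x | trans (≡-sym (lookup∘tabulate _ x)) ([]=⇒lookup x∈)
... | yes px | _  = px
... | no _   | ()

∈-tabulate-does⁺ : ∀ {n} {P : Fin n → Set} (P? : ∀ x → Dec (P x)) {x} →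
  P x → x ∈ tabulate (λ y → does (P? y))
∈-tabulate-does⁺ {P = P} P? {x} px = lookup⇒[]= x _ (trans (lookup∘tabulate _ x) (does-true (P? x)))
  where
  does-true : (D : Dec (P x)) → does D ≡ true
  does-true (yes _) = refl
  does-true (no ¬px) = ⊥-elim (¬px px)

∣p∪q∣≤∣p∣+∣q∣ : ∀ {n} (p q : Subset n) → ∣ p ∪ q ∣ ℕ.≤ ∣ p ∣ ℕ.+ ∣ q ∣
∣p∪q∣≤∣p∣+∣q∣ []            []            = ℕ.z≤n
∣p∪q∣≤∣p∣+∣q∣ (outside ∷ p) (outside ∷ q) = ∣p∪q∣≤∣p∣+∣q∣ p q
∣p∪q∣≤∣p∣+∣q∣ (outside ∷ p) (inside ∷ q)  =
  ℕₚ.≤-trans (ℕ.s≤s (∣p∪q∣≤∣p∣+∣q∣ p q)) (ℕₚ.≤-reflexive (≡-sym (ℕₚ.+-suc ∣ p ∣ ∣ q ∣)))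
∣p∪q∣≤∣p∣+∣q∣ (inside ∷ p)  (outside ∷ q) = ℕ.s≤s (∣p∪q∣≤∣p∣+∣q∣ p q)
∣p∪q∣≤∣p∣+∣q∣ (inside ∷ p)  (inside ∷ q)  =
  ℕ.s≤s (ℕₚ.≤-trans (∣p∪q∣≤∣p∣+∣q∣ p q) (ℕₚ.+-monoʳ-≤ ∣ p ∣ (ℕₚ.n≤1+n ∣ q ∣)))

∣p─q∣+∣p∩q∣≡∣p∣ : ∀ {n} (p q : Subset n) → ∣ p ─ q ∣ ℕ.+ ∣ p ∩ q ∣ ≡ ∣ p ∣
∣p─q∣+∣p∩q∣≡∣p∣ []            []            = refl
∣p─q∣+∣p∩q∣≡∣p∣ (outside ∷ p) (outside ∷ q) = ∣p─q∣+∣p∩q∣≡∣p∣ p q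
∣p─q∣+∣p∩q∣≡∣p∣ (outside ∷ p) (inside ∷ q)  = ∣p─q∣+∣p∩q∣≡∣p∣ p q
∣p─q∣+∣p∩q∣≡∣p∣ (inside ∷ p)  (outside ∷ q) = cong suc (∣p─q∣+∣p∩q∣≡∣p∣ p q)
∣p─q∣+∣p∩q∣≡∣p∣ (inside ∷ p)  (inside ∷ q)  =
  trans (ℕₚ.+-suc _ _) (cong suc (∣p─q∣+∣p∩q∣≡∣p∣ p q))

x∈p─q⇒x∉q : ∀ {n} (p q : Subset n) {x} → x ∈ p ─ q → x ∉ q
x∈p─q⇒x∉q (_ ∷ p) (inside ∷ q)  ()        here
x∈p─q⇒x∉q (_ ∷ p) (outside ∷ q) (there h) (there h') = x∈p─q⇒x∉q p q h h'
x∈p─q⇒x∉q (_ ∷ p) (inside ∷ q)  (there h) (there h') = x∈p─q⇒x∉q p q h h'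

image : ∀ {m n} → (Fin m → Fin n) → Subset m → Subset n
image f []            = ⊥
image f (outside ∷ p) = image (λ i → f (Data.Fin.suc i)) p
image f (inside ∷ p)  = ⁅ f Data.Fin.zero ⁆ ∪ image (λ i → f (Data.Fin.suc i)) p

∣image∣≤∣p∣ : ∀ {m n} (f : Fin m → Fin n) (p : Subset m) → ∣ image f p ∣ ℕ.≤ ∣ p ∣
∣image∣≤∣p∣ {n = n} f [] = ℕₚ.≤-reflexive (∣⊥∣≡0 n)
∣image∣≤∣p∣ f (outside ∷ p) = ∣image∣≤∣p∣ _ p
∣image∣≤∣p∣ {suc m} {n} f (inside ∷ p) = ℕₚ.≤-trans (∣p∪q∣≤∣p∣+∣q∣ ⁅ f Data.Fin.zero ⁆ _)
  (ℕₚ.≤-trans (ℕₚ.≤-reflexive (cong (ℕ._+ ∣ image f′ p ∣) (∣⁅x⁆∣≡1 (f Data.Fin.zero))))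
    (ℕ.s≤s (∣image∣≤∣p∣ f′ p)))
  where
  f′ : Fin m → Fin n
  f′ i = f (Data.Fin.suc i)

∈image⁺ : ∀ {m n} (f : Fin m → Fin n) (p : Subset m) {x} → x ∈ p → f x ∈ image f p
∈image⁺ f (inside ∷ p)  here      = x∈p∪q⁺ (inj₁ (x∈⁅x⁆ _))
∈image⁺ f (inside ∷ p)  (there h) = x∈p∪q⁺ (inj₂ (∈image⁺ _ p h))
∈image⁺ f (outside ∷ p) (there h) = ∈image⁺ _ p h

image⊆ : ∀ {m n} (f : Fin m → Fin n) (p : Subset m) {q : Subset n} →
  (∀ {x} → x ∈ p → f x ∈ q) → image f p ⊆ q
image⊆ f []            f∈ y∈ = ⊥-elim (∉⊥ y∈)
image⊆ f (outside ∷ p) f∈ y∈ = image⊆ _ p (λ x∈ → f∈ (there x∈)) y∈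
image⊆ f (inside ∷ p)  f∈ y∈ with x∈p∪q⁻ ⁅ f Data.Fin.zero ⁆ _ y∈
... | inj₁ y∈⁅f0⁆ = subst (_∈ _) (≡-sym (x∈⁅y⁆⇒x≡y _ y∈⁅f0⁆)) (f∈ here)
... | inj₂ y∈im   = image⊆ _ p (λ x∈ → f∈ (there x∈)) y∈im

sumOver-mono-⊆ : ∀ {n} (α : Fin n → ℚ) → (∀ u → 0ℚ ≤ α u) →
  ∀ {p q} → p ⊆ q → sumOver α p ≤ sumOver α q
sumOver-mono-⊆ {ℕ.zero} α α≥0 {[]} {[]} _ = ℚₚ.≤-refl
sumOver-mono-⊆ {suc n} α α≥0 {outside ∷ p} {outside ∷ q} p⊆q =
  ℚₚ.+-monoʳ-≤ 0ℚ (sumOver-mono-⊆ _ (λ u → α≥0 _) (drop-∷-⊆ p⊆q))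
sumOver-mono-⊆ {suc n} α α≥0 {outside ∷ p} {inside ∷ q} p⊆q =
  ℚₚ.+-mono-≤ (α≥0 _) (sumOver-mono-⊆ _ (λ u → α≥0 _) (drop-∷-⊆ p⊆q))
sumOver-mono-⊆ {suc n} α α≥0 {inside ∷ p} {outside ∷ q} p⊆q with p⊆q here
... | ()
sumOver-mono-⊆ {suc n} α α≥0 {inside ∷ p} {inside ∷ q} p⊆q =
  ℚₚ.+-monoʳ-≤ (α Data.Fin.zero) (sumOver-mono-⊆ _ (λ u → α≥0 _) (drop-∷-⊆ p⊆q))

module _ {n : ℕ} (M : FiniteMetric n) where

  NearBy : Subset n → ℚ → Fin n → Set
  NearBy A r u = ∃ λ a → a ∈ A × d M a u ≤ r

  nearBy? : ∀ A r u → Dec (NearBy A r u)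
  nearBy? A r u = any? λ a → (a ∈? A) ×-dec (d M a u ℚₚ.≤? r)

  ∈Ball⁻ : ∀ {A r u} → u ∈ Ball M A r → NearBy A r u
  ∈Ball⁻ {A} {r} = ∈-tabulate-does⁻ (nearBy? A r)

  ∈Ball⁺ : ∀ {A r u} a → a ∈ A → d M a u ≤ r → u ∈ Ball M A r
  ∈Ball⁺ {A} {r} a a∈A dau≤r = ∈-tabulate-does⁺ (nearBy? A r) (a , a∈A , dau≤r)

  anchor : Subset n → ℚ → Fin n → Fin n
  anchor A r u with nearBy? A r u
  ... | yes (a , _) = a
  ... | no _        = u

  anchor-near : ∀ {A r u} → u ∈ Ball M A r → anchor A r u ∈ A × d M (anchor A r u) u ≤ r
  anchor-near {A} {r} {u} u∈B with nearBy? A r u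
  ... | yes (a , a∈A , dau≤r) = a∈A , dau≤r
  ... | no ¬near              = ⊥-elim (¬near (∈Ball⁻ u∈B))

  relocate : Subset n → ℚ → Subset n → Subset n
  relocate S r C = (C ─ Ball M S r) ∪ image (anchor S r) (C ∩ Ball M S r)

  Ball⊆Ball-relocate : ∀ S {r} C → 0ℚ ≤ r → Ball M C r ⊆ Ball M (relocate S r C) (r + r)
  Ball⊆Ball-relocate S {r} C r≥0 {u} u∈B with ∈Ball⁻ u∈B
  ... | c , c∈C , dcu≤r with c ∈? Ball M S r
  ... | yes c∈BS = ∈Ball⁺ (anchor S r c)
          (x∈p∪q⁺ (inj₂ (∈image⁺ (anchor S r) (C ∩ Ball M S r) (x∈p∩q⁺ (c∈C , c∈BS)))))
          (ℚₚ.≤-trans (triangle M _ c u) (ℚₚ.+-mono-≤ (proj₂ (anchor-near c∈BS)) dcu≤r))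
  ... | no c∉BS = ∈Ball⁺ c (x∈p∪q⁺ (inj₁ (x∈p∧x∉q⇒x∈p─q c∈C c∉BS)))
          (ℚₚ.≤-trans dcu≤r (subst (_≤ r + r) (ℚₚ.+-identityʳ r) (ℚₚ.+-monoʳ-≤ r r≥0)))

  ∣relocate∣≤∣C∣ : ∀ S r C → ∣ relocate S r C ∣ ℕ.≤ ∣ C ∣
  ∣relocate∣≤∣C∣ S r C = begin
    ∣ relocate S r C ∣                                        ≤⟨ ∣p∪q∣≤∣p∣+∣q∣ (C ─ Ball M S r) _ ⟩
    ∣ C ─ Ball M S r ∣ ℕ.+ ∣ image (anchor S r) (C ∩ Ball M S r) ∣
                                         ≤⟨ ℕₚ.+-monoʳ-≤ ∣ C ─ Ball M S r ∣ (∣image∣≤∣p∣ (anchor S r) (C ∩ Ball M S r)) ⟩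
    ∣ C ─ Ball M S r ∣ ℕ.+ ∣ C ∩ Ball M S r ∣                 ≡⟨ ∣p─q∣+∣p∩q∣≡∣p∣ C (Ball M S r) ⟩
    ∣ C ∣                                                     ∎
    where open ℕₚ.≤-Reasoning

  relocate─S⊆C─Ball : ∀ S r C → relocate S r C ─ S ⊆ C ─ Ball M S r
  relocate─S⊆C─Ball S r C x∈ with x∈p∪q⁻ (C ─ Ball M S r) _ (p─q⊆p _ S x∈)
  ... | inj₁ x∈C─BS = x∈C─BS
  ... | inj₂ x∈im   = ⊥-elim (x∈p─q⇒x∉q _ S x∈
          (image⊆ (anchor S r) (C ∩ Ball M S r)
            (λ c∈ → proj₁ (anchor-near (proj₂ (x∈p∩q⁻ C _ c∈)))) x∈im))

feasibleAM-transfer : ∀ {n} (I : ColorfulInstance n) (α : Fin n → ℚ) → (∀ u → 0ℚ ≤ α u) →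
  ∀ {μ r r′ C C′} → ∣ C′ ∣ ℕ.≤ ∣ C ∣ → Ball (metric I) C r ⊆ Ball (metric I) C′ r′ →
  FeasibleAM I α μ r C → FeasibleAM I α μ r′ C′
feasibleAM-transfer I α α≥0 ∣C′∣≤∣C∣ B⊆B′ ((∣C∣≤k , covers) , μ<Σ) =
  (ℕₚ.≤-trans ∣C′∣≤∣C∣ ∣C∣≤k , λ ℓ → ℕₚ.≤-trans (covers ℓ) (p⊆q⇒∣p∣≤∣q∣ (∩-monoˡ B⊆B′))) ,
  ℚₚ.<-≤-trans μ<Σ (sumOver-mono-⊆ α α≥0 B⊆B′)
  where
  ∩-monoˡ : ∀ {p q r : Subset _} → p ⊆ q → p ∩ r ⊆ q ∩ r
  ∩-monoˡ p⊆q x∈ = x∈p∩q⁺ (p⊆q (proj₁ (x∈p∩q⁻ _ _ x∈)) , proj₂ (x∈p∩q⁻ _ _ x∈))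

m+[1+n]≤o⇒m≤o∸n∸1 : ∀ m n o → m ℕ.+ suc n ℕ.≤ o → m ℕ.≤ o ∸ n ∸ 1
m+[1+n]≤o⇒m≤o∸n∸1 m n o le rewrite ℕₚ.∸-+-assoc o n 1 =
  ℕₚ.m+n≤o⇒m≤o∸n m (subst (λ k → m ℕ.+ k ℕ.≤ o) (ℕₚ.+-comm 1 n) le)

lemma8 : ∀ {n} (I : ColorfulInstance n) →
    1 Data.Nat.≤ γ I → 1 Data.Nat.≤ k I →
    (α : Fin n → ℚ) → (∀ u → 0ℚ ≤ α u) → (μ : ℚ) →
    (r : ℚ) → 0ℚ ≤ r →
    (S : Subset n) →
    (∀ s s' → s ∈ S → s' ∈ S → ¬ s ≡ s' → (r + r) + (r + r) < d (metric I) s s') →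
    (τ : ℕ) → τ Data.Nat.< k I →
    Σ[ C₁ ∈ Subset n ] (FeasibleAM I α μ r C₁ × τ Data.Nat.< ∣ C₁ ∩ Ball (metric I) S r ∣) →
    Σ[ C₂ ∈ Subset n ] (FeasibleAM I α μ (r + r) C₂ × ∣ C₂ ─ S ∣ Data.Nat.≤ k I ∸ τ ∸ 1)
lemma8 I _ _ α α≥0 μ r r≥0 S _ τ _ (C₁ , C₁-feasible , τ<∣C₁∩BS∣) =
  relocate M S r C₁ ,
  feasibleAM-transfer I α α≥0 (∣relocate∣≤∣C∣ M S r C₁) (Ball⊆Ball-relocate M S C₁ r≥0) C₁-feasible ,
  ℕₚ.≤-trans (p⊆q⇒∣p∣≤∣q∣ (relocate─S⊆C─Ball M S r C₁))
    (m+[1+n]≤o⇒m≤o∸n∸1 ∣ C₁ ─ BS ∣ τ (k I) ∣C₁─BS∣+[1+τ]≤k)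
  where
  M : FiniteMetric _
  M = metric I
  BS : Subset _
  BS = Ball M S r
  ∣C₁─BS∣+[1+τ]≤k : ∣ C₁ ─ BS ∣ ℕ.+ suc τ ℕ.≤ k I
  ∣C₁─BS∣+[1+τ]≤k = begin
    ∣ C₁ ─ BS ∣ ℕ.+ suc τ          ≤⟨ ℕₚ.+-monoʳ-≤ ∣ C₁ ─ BS ∣ τ<∣C₁∩BS∣ ⟩
    ∣ C₁ ─ BS ∣ ℕ.+ ∣ C₁ ∩ BS ∣    ≡⟨ ∣p─q∣+∣p∩q∣≡∣p∣ C₁ BS ⟩
    ∣ C₁ ∣                         ≤⟨ proj₁ (proj₁ C₁-feasible) ⟩
    k I                            ∎
    where open ℕₚ.≤-Reasoning
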